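{- Let $G$ be a graph of diameter $2$ and let $F\subseteq E(G)$. Then $S_F$ is a mutual-visibility set of $L(G)$ if and only if for any two independent (i.e., non-incident) edges $uv,u'v'\in F$ one of the following holds: (i) there is an edge $xy\notin F$ that is incident with both $uv$ and $u'v'$; or (ii) $d_{L(G)}(e_{uv},e_{u'v'})=3$ and there exist an endpoint $a\in\{u,v\}$, an endpoint $a'\in\{u',v'\}$, and a vertex $z\in V(G)$ adjacent to both $a$ and $a'$ in $G$ such that $az\notin F$ and $a'z\notin F$.
   Context: The line graph $L(G)$ has vertex set $\{e_{uv}: uv\in E(G)\}$, with $e_{uv}$ and $e_{u'v'}$ adjacent iff the edges $uv,u'v'$ share an endpoint. For $F\subseteq E(G)$, $S_F=\{e_{uv}: uv\in F\}$. For a connected graph $H$ and $X\subseteq V(H)$, two vertices are $X$-visible if there is a shortest path between them whose internal vertices are not in $X$; $X$ is a mutual-visibility set of $H$ if every two vertices of $X$ are $X$-visible. -}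

module Defs where

open import Data.Nat using (ℕ; zero; suc; _≤_)
open import Data.Fin using (Fin; _<_)
open import Data.Bool using (Bool; true; false)
open import Data.Product using (Σ; ∃; ∃-syntax; _×_; _,_)
open import Data.Sum using (_⊎_)
open import Data.Empty using (⊥)
open import Data.Unit using (⊤)
open import Relation.Nullary using (¬_)
open import Relation.Binary.PropositionalEquality using (_≡_; _≢_)

module _ {V : Set} (Adj : V → V → Set) where

  data Walk : V → V → ℕ → Set where
    nil  : ∀ {x} → Walk x x 0
    cons : ∀ {x y z k} → Adj x y → Walk y z k → Walk x z (suc k)

  Dist : V → V → ℕ → Set
  Dist x y d = Walk x y d × (∀ k → Walk x y k → d ≤ k)

  InternalAvoid : (V → Set) → ∀ {x y k} → Walk x y k → Set
  InternalAvoid X nil = ⊤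
  InternalAvoid X (cons _ nil) = ⊤
  InternalAvoid X (cons {y = y} _ w@(cons _ _)) = ¬ X y × InternalAvoid X w

  Visible : (V → Set) → V → V → Set
  Visible X x y = Σ ℕ λ d → Σ (Walk x y d) λ w → Dist x y d × InternalAvoid X w

  MutualVisibility : (V → Set) → Set
  MutualVisibility X = ∀ x y → X x → X y → Visible X x y

record SimpleGraph (n : ℕ) : Set where
  field
    adj    : Fin n → Fin n → Bool
    sym    : ∀ u v → adj u v ≡ adj v u
    irrefl : ∀ u → adj u u ≡ false

module _ {n : ℕ} (G : SimpleGraph n) where
  open SimpleGraph G

  Adj : Fin n → Fin n → Set
  Adj u v = adj u v ≡ true

  Diameter2 : Set
  Diameter2 = (∀ u v → ∃[ d ] (Dist Adj u v d × d ≤ 2))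
            × (∃[ u ] ∃[ v ] Dist Adj u v 2)

  -- an edge uv of G, stored with u < v so that each edge appears once
  record Edge : Set where
    constructor edge
    field
      lo hi : Fin n
      lo<hi : lo < hi
      isAdj : adj lo hi ≡ true

  open Edge public

  HasEnd : Edge → Fin n → Set
  HasEnd e w = w ≡ lo e ⊎ w ≡ hi e

  Incident : Edge → Edge → Set
  Incident e e' = ∃[ w ] (HasEnd e w × HasEnd e' w)

  EdgeOn : Edge → Fin n → Fin n → Set
  EdgeOn e a b = (lo e ≡ a × hi e ≡ b) ⊎ (lo e ≡ b × hi e ≡ a)

  NotInF : (Edge → Set) → Fin n → Fin n → Set
  NotInF F a b = ∀ e → EdgeOn e a b → ¬ F e

  LAdj : Edge → Edge → Set
  LAdj e e' = e ≢ e' × Incident e e'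

  -- S_F = {e_uv : uv ∈ F} as a vertex subset of L(G) is F itself
  -- the condition on two independent edges e = uv, e' = u'v' of F
  Condition : (Edge → Set) → Edge → Edge → Set
  Condition F e e' =
      (∃[ f ] (¬ F f × Incident f e × Incident f e'))
    ⊎ (Dist LAdj e e' 3
       × ∃[ a ] ∃[ a' ] ∃[ z ]
           (HasEnd e a × HasEnd e' a' × Adj a z × Adj a' z
            × NotInF F a z × NotInF F a' z))

-- Between independent edges of a diameter-2 graph G, the line graph L(G) has distance 2 or 3:
-- a G-path of length ≤ 2 joining their endpoints lifts to an L(G)-walk of length ≤ 3.
-- A shortest path of length 2 passes through one edge incident with both, which is condition (i).
-- A shortest path e, f₁, f₂, e′ of length 3 has f₁ = az and f₂ = a′z with a ∈ e, a′ ∈ e′: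
-- otherwise f₁ or f₂ would already be incident with both e and e′. This is condition (ii),
-- and conversely such edges outside F give a shortest path with no internal vertex in S_F.

module Submission where

open import Defs
open import Data.Nat using (ℕ; zero; suc; _≤_; _<_; z≤n; s≤s)
open import Data.Nat.Properties using (≤-refl; ≤-trans; <⇒≱; m≤m+n; m≤n⇒m≤1+n)
import Data.Fin as Fin
open import Data.Fin.Properties using (_≟_; <-cmp; <-asym; <-irrelevant; any?)
import Data.Bool as Bool
open import Data.Product using (∃-syntax; _×_; _,_; proj₂; uncurry)
open import Data.Sum using (_⊎_; inj₁; inj₂)
open import Data.Empty using (⊥; ⊥-elim)
open import Data.Unit using (tt)
open import Relation.Nullary using (¬_; Dec; yes; no)
open import Relation.Nullary.Decidable using (map′; _×-dec_; _⊎-dec_)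
open import Relation.Binary using (tri<; tri≈; tri>)
open import Relation.Binary.Construct.Closure.Reflexive using (ReflClosure; [_])
  renaming (refl to stay)
open import Relation.Binary.PropositionalEquality
open import Axiom.UniquenessOfIdentityProofs using (module Decidable⇒UIP)
open import Function.Bundles using (_⇔_; mk⇔)

module _ {V : Set} {R : V → V → Set} where

  walk₀⇒≡ : ∀ {x y} → Walk R x y 0 → x ≡ y
  walk₀⇒≡ nil = refl

  walk₁⇒edge : ∀ {x y} → Walk R x y 1 → R x y
  walk₁⇒edge (cons r nil) = r

  shorter⇒⊥ : ∀ {x y d k} → (∀ j → Walk R x y j → d ≤ j) → Walk R x y k → k < d → ⊥
  shorter⇒⊥ minimal w k<d = <⇒≱ k<d (minimal _ w)

  shortest⇒visible : ∀ {X x y d} (w : Walk R x y d) →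
    (∀ k → Walk R x y k → d ≤ k) → InternalAvoid R X w → Visible R X x y
  shortest⇒visible w minimal avoid = _ , w , (w , minimal) , avoid

  visible-refl : ∀ {X x} → Visible R X x x
  visible-refl = shortest⇒visible nil (λ _ _ → z≤n) tt

  adjacent⇒visible : ∀ {X x y} → x ≢ y → R x y → Visible R X x y
  adjacent⇒visible {x = x} {y} x≢y r = shortest⇒visible (cons r nil) minimal tt
    where
    minimal : ∀ k → Walk R x y k → 1 ≤ k
    minimal zero    w = ⊥-elim (x≢y (walk₀⇒≡ w))
    minimal (suc _) _ = s≤s z≤n

  dropStays : ∀ {x y k} → Walk (ReflClosure R) x y k → ∃[ j ] (j ≤ k × Walk R x y j)
  dropStays nil = 0 , z≤n , nil
  dropStays (cons stay w) with dropStays w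
  ... | j , j≤k , w′ = j , m≤n⇒m≤1+n j≤k , w′
  dropStays (cons [ r ] w) with dropStays w
  ... | j , j≤k , w′ = suc j , s≤s j≤k , cons r w′

module LineGraph {n : ℕ} (G : SimpleGraph n) where
  open SimpleGraph G using (irrefl) renaming (sym to adj-sym)

  E : Set
  E = Edge G

  L : E → E → Set
  L = LAdj G

  ≡-fromEnds : ∀ {e e′ : E} → lo e ≡ lo e′ → hi e ≡ hi e′ → e ≡ e′
  ≡-fromEnds {edge l h l<h a} {edge .l .h l<h′ a′} refl refl
    rewrite <-irrelevant l<h l<h′ | Decidable⇒UIP.≡-irrelevant Bool._≟_ a a′ = refl

  _≟ᴱ_ : (e e′ : E) → Dec (e ≡ e′)
  e ≟ᴱ e′ = map′ (uncurry ≡-fromEnds) (λ { refl → refl , refl })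
                 (lo e ≟ lo e′ ×-dec hi e ≟ hi e′)

  hasEnd? : ∀ e w → Dec (HasEnd G e w)
  hasEnd? e w = w ≟ lo e ⊎-dec w ≟ hi e

  incident? : ∀ e e′ → Dec (Incident G e e′)
  incident? e e′ = any? λ w → hasEnd? e w ×-dec hasEnd? e′ w

  incident-refl : ∀ e → Incident G e e
  incident-refl e = lo e , inj₁ refl , inj₁ refl

  incident-sym : ∀ e e′ → Incident G e e′ → Incident G e′ e
  incident-sym _ _ (w , ew , e′w) = w , e′w , ew

  incident⇒stayOrL : ∀ e e′ → Incident G e e′ → ReflClosure L e e′
  incident⇒stayOrL e e′ i with e ≟ᴱ e′
  ... | yes refl = stay
  ... | no e≢e′  = [ e≢e′ , i ]

  EdgeOn⇒HasEnd₁ : ∀ f {a b} → EdgeOn G f a b → HasEnd G f a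
  EdgeOn⇒HasEnd₁ _ (inj₁ (refl , _)) = inj₁ refl
  EdgeOn⇒HasEnd₁ _ (inj₂ (_ , refl)) = inj₂ refl

  EdgeOn⇒HasEnd₂ : ∀ f {a b} → EdgeOn G f a b → HasEnd G f b
  EdgeOn⇒HasEnd₂ _ (inj₁ (_ , refl)) = inj₂ refl
  EdgeOn⇒HasEnd₂ _ (inj₂ (refl , _)) = inj₁ refl

  EdgeOn⇒Adj : ∀ f {a b} → EdgeOn G f a b → Adj G a b
  EdgeOn⇒Adj f (inj₁ (refl , refl)) = isAdj f
  EdgeOn⇒Adj f (inj₂ (refl , refl)) = trans (adj-sym (hi f) (lo f)) (isAdj f)

  EdgeOn-unique : ∀ {f g a b} → EdgeOn G f a b → EdgeOn G g a b → f ≡ g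
  EdgeOn-unique (inj₁ (refl , refl)) (inj₁ (p , q)) = ≡-fromEnds (sym p) (sym q)
  EdgeOn-unique (inj₂ (refl , refl)) (inj₂ (p , q)) = ≡-fromEnds (sym p) (sym q)
  EdgeOn-unique {f} {g} (inj₁ (refl , refl)) (inj₂ (p , q)) =
    ⊥-elim (<-asym (lo<hi f) (subst₂ Fin._<_ p q (lo<hi g)))
  EdgeOn-unique {f} {g} (inj₂ (refl , refl)) (inj₁ (p , q)) =
    ⊥-elim (<-asym (lo<hi f) (subst₂ Fin._<_ p q (lo<hi g)))

  edgeOn : ∀ a b → Adj G a b → ∃[ f ] EdgeOn G f a b
  edgeOn a b ab with <-cmp a b
  ... | tri< a<b _ _ = edge a b a<b ab , inj₁ (refl , refl)
  ... | tri> _ _ b<a = edge b a b<a (trans (adj-sym b a) ab) , inj₂ (refl , refl)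
  ... | tri≈ _ refl _ with trans (sym ab) (irrefl a)
  ...   | ()

  HasEnd-pair : ∀ f {a b} → HasEnd G f a → HasEnd G f b → a ≡ b ⊎ EdgeOn G f a b
  HasEnd-pair _ (inj₁ refl) (inj₁ refl) = inj₁ refl
  HasEnd-pair _ (inj₁ refl) (inj₂ refl) = inj₂ (inj₁ (refl , refl))
  HasEnd-pair _ (inj₂ refl) (inj₁ refl) = inj₂ (inj₂ (refl , refl))
  HasEnd-pair _ (inj₂ refl) (inj₂ refl) = inj₁ refl

  ∉⇒NotInF : ∀ {F : E → Set} {f a b} → ¬ F f → EdgeOn G f a b → NotInF G F a b
  ∉⇒NotInF {F} f∉F f-ab g g-ab g∈F = f∉F (subst F (EdgeOn-unique g-ab f-ab) g∈F)

  liftWalk : ∀ {e e′ u u′ k} → HasEnd G e u → Walk (Adj G) u u′ k → HasEnd G e′ u′ →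
    Walk (ReflClosure L) e e′ (suc k)
  liftWalk {e} {e′} {u} eu nil e′u = cons (incident⇒stayOrL e e′ (u , eu , e′u)) nil
  liftWalk {e} {u = u} eu (cons {y = y} uy w) e′u′ with edgeOn u y uy
  ... | f , f-uy = cons (incident⇒stayOrL e f (u , eu , EdgeOn⇒HasEnd₁ f f-uy))
                        (liftWalk (EdgeOn⇒HasEnd₂ f f-uy) w e′u′)

  diameter2⇒L-walk≤3 : Diameter2 G → ∀ e e′ → ∃[ k ] (k ≤ 3 × Walk L e e′ k)
  diameter2⇒L-walk≤3 (bounded , _) e e′ with bounded (lo e) (lo e′)
  ... | d , (w , _) , d≤2 with dropStays (liftWalk (inj₁ refl) w (inj₁ refl))
  ...   | k , k≤1+d , w′ = k , ≤-trans k≤1+d (s≤s d≤2) , w′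

  module Independent {e e′ : E} (e∦e′ : ¬ Incident G e e′) where

    2≤length : ∀ {k} → Walk L e e′ k → 2 ≤ k
    2≤length {zero}  w = ⊥-elim (e∦e′ (subst (Incident G e) (walk₀⇒≡ w) (incident-refl e)))
    2≤length {suc zero} w = ⊥-elim (e∦e′ (proj₂ (walk₁⇒edge w)))
    2≤length {suc (suc _)} _ = s≤s (s≤s z≤n)

    walkVia : ∀ f → Incident G e f → Incident G f e′ → Walk L e e′ 2
    walkVia f ef fe′ = cons (e≢f , ef) (cons (f≢e′ , fe′) nil)
      where
      e≢f : e ≢ f
      e≢f refl = e∦e′ fe′
      f≢e′ : f ≢ e′
      f≢e′ refl = e∦e′ ef

    noCommonNeighbour : (∀ k → Walk L e e′ k → 3 ≤ k) → ∀ f → Incident G e f → Incident G f e′ → ⊥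
    noCommonNeighbour minimal f ef fe′ = shorter⇒⊥ minimal (walkVia f ef fe′) ≤-refl

    middleEdges : ∀ {f₁ f₂} → (∀ k → Walk L e e′ k → 3 ≤ k) →
      L e f₁ → L f₁ f₂ → L f₂ e′ →
      ∃[ a ] ∃[ a′ ] ∃[ z ] (HasEnd G e a × HasEnd G e′ a′ × EdgeOn G f₁ a z × EdgeOn G f₂ a′ z)
    middleEdges {f₁} {f₂} minimal (_ , a , ea , f₁a) (_ , z , f₁z , f₂z) (_ , a′ , f₂a′ , e′a′)
      with HasEnd-pair f₁ f₁a f₁z | HasEnd-pair f₂ f₂a′ f₂z
    ... | inj₁ refl | _ = ⊥-elim (noCommonNeighbour minimal f₂ (a , ea , f₂z) (a′ , f₂a′ , e′a′))
    ... | inj₂ _ | inj₁ refl = ⊥-elim (noCommonNeighbour minimal f₁ (a , ea , f₁a) (a′ , f₁z , e′a′))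
    ... | inj₂ f₁-az | inj₂ f₂-a′z = a , a′ , z , ea , e′a′ , f₁-az , f₂-a′z

  incident⇒visible : ∀ {X e e′} → Incident G e e′ → Visible L X e e′
  incident⇒visible {e = e} {e′} i with incident⇒stayOrL e e′ i
  ... | stay          = visible-refl
  ... | [ e≢e′ , _ ] = adjacent⇒visible e≢e′ (e≢e′ , i)

  module _ (F : E → Set) where
    open Independent

    visible⇒condition : Diameter2 G → ∀ {e e′} → ¬ Incident G e e′ → Visible L F e e′ →
      Condition G F e e′
    visible⇒condition _ {e} e∦e′ (_ , nil , _) = ⊥-elim (e∦e′ (incident-refl e))
    visible⇒condition _ e∦e′ (_ , cons (_ , i) nil , _) = ⊥-elim (e∦e′ i)
    visible⇒condition _ {e} _ (_ , cons {y = f} (_ , ef) (cons (_ , fe′) nil) , _ , f∉F , _) =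
      inj₁ (f , f∉F , incident-sym e f ef , fe′)
    visible⇒condition _ e∦e′
      (_ , cons {y = f₁} p₁ (cons {y = f₂} p₂ (cons p₃ nil)) , shortest , f₁∉F , f₂∉F , _)
      with middleEdges e∦e′ (proj₂ shortest) p₁ p₂ p₃
    ... | a , a′ , z , ea , e′a′ , f₁-az , f₂-a′z =
      inj₂ (shortest , a , a′ , z , ea , e′a′ , EdgeOn⇒Adj f₁ f₁-az , EdgeOn⇒Adj f₂ f₂-a′z ,
            ∉⇒NotInF f₁∉F f₁-az , ∉⇒NotInF f₂∉F f₂-a′z)
    visible⇒condition d2 _ (_ , cons _ (cons _ (cons _ (cons _ _))) , (_ , minimal) , _)
      with diameter2⇒L-walk≤3 d2 _ _
    ... | k , k≤3 , w = ⊥-elim (shorter⇒⊥ minimal w (≤-trans (s≤s k≤3) (m≤m+n 4 _)))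

    condition⇒visible : ∀ {e e′} → F e → F e′ → ¬ Incident G e e′ → Condition G F e e′ →
      Visible L F e e′
    condition⇒visible {e} _ _ e∦e′ (inj₁ (f , f∉F , fe , fe′)) =
      shortest⇒visible (walkVia e∦e′ f (incident-sym f e fe) fe′) (λ _ → 2≤length e∦e′) (f∉F , tt)
    condition⇒visible {e} {e′} e∈F e′∈F e∦e′
      (inj₂ ((_ , minimal) , a , a′ , z , ea , e′a′ , az , a′z , az∉F , a′z∉F))
      with edgeOn a z az | edgeOn a′ z a′z
    ... | f₁ , f₁-az | f₂ , f₂-a′z = shortest⇒visible path minimal (f₁∉F , f₂∉F , tt)
      where
      f₁∉F : ¬ F f₁
      f₁∉F = az∉F f₁ f₁-az
      f₂∉F : ¬ F f₂
      f₂∉F = a′z∉F f₂ f₂-a′z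
      e≢f₁ : e ≢ f₁
      e≢f₁ refl = f₁∉F e∈F
      f₂≢e′ : f₂ ≢ e′
      f₂≢e′ refl = f₂∉F e′∈F
      f₁≢f₂ : f₁ ≢ f₂
      f₁≢f₂ refl = noCommonNeighbour e∦e′ minimal f₁
        (a , ea , EdgeOn⇒HasEnd₁ f₁ f₁-az) (a′ , EdgeOn⇒HasEnd₁ f₂ f₂-a′z , e′a′)
      path : Walk L e e′ 3
      path = cons (e≢f₁ , a , ea , EdgeOn⇒HasEnd₁ f₁ f₁-az)
            (cons (f₁≢f₂ , z , EdgeOn⇒HasEnd₂ f₁ f₁-az , EdgeOn⇒HasEnd₂ f₂ f₂-a′z)
            (cons (f₂≢e′ , a′ , EdgeOn⇒HasEnd₁ f₂ f₂-a′z , e′a′) nil))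

    conditions⇒mutualVisibility :
      (∀ e e′ → F e → F e′ → ¬ Incident G e e′ → Condition G F e e′) → MutualVisibility L F
    conditions⇒mutualVisibility cond e e′ e∈F e′∈F with incident? e e′
    ... | yes i    = incident⇒visible i
    ... | no e∦e′ = condition⇒visible e∈F e′∈F e∦e′ (cond e e′ e∈F e′∈F e∦e′)

lemma3p1 : ∀ {n : ℕ} (G : SimpleGraph n) → Diameter2 G → (F : Edge G → Set) →
    (MutualVisibility (LAdj G) F
      ⇔ (∀ e e' → F e → F e' → ¬ Incident G e e' → Condition G F e e'))
lemma3p1 G d2 F = mk⇔
  (λ visible e e′ e∈F e′∈F e∦e′ → visible⇒condition F d2 e∦e′ (visible e e′ e∈F e′∈F))
  (conditions⇒mutualVisibility F)
  where open LineGraph G
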